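{- Let $A$ be the adjacency matrix of a (finite simple undirected) graph $G$ and let $l>2$ be an integer. Then $\mu_{A\otimes A_{K_l}}(-1) = (l-1)\cdot\mu_A(1)$.
   Context: $K_l$ is the complete graph on $l$ vertices with adjacency matrix $A_{K_l}$; $\otimes$ is the Kronecker product of matrices. For a diagonalizable matrix $M$ and real $\lambda$, $\mu_M(\lambda)$ denotes the multiplicity of $\lambda$ as an eigenvalue of $M$ (zero if it is not an eigenvalue). -}

module Defs where

open import Data.Nat using (ℕ; zero; suc)
open import Data.Fin using (Fin; zero; suc; _≟_; quotient; remainder)
open import Data.Bool using (Bool; true; false)
open import Data.Rational using (ℚ; 0ℚ; 1ℚ; _+_; _*_)
open import Data.Product using (_×_; Σ; _,_)
open import Relation.Binary.PropositionalEquality using (_≡_)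
open import Relation.Nullary using (¬_; does)

Matrix : ℕ → Set
Matrix n = Fin n → Fin n → ℚ

Vector : ℕ → Set
Vector n = Fin n → ℚ

∑ : ∀ {n} → (Fin n → ℚ) → ℚ
∑ {zero}  f = 0ℚ
∑ {suc n} f = f zero + ∑ (λ i → f (suc i))

_·ᵥ_ : ∀ {n} → Matrix n → Vector n → Vector n
(M ·ᵥ v) i = ∑ (λ j → M i j * v j)

record SimpleGraph (n : ℕ) : Set where
  field
    adj   : Fin n → Fin n → Bool
    sym   : ∀ i j → adj i j ≡ adj j i
    irrefl : ∀ i → adj i i ≡ false

boolToℚ : Bool → ℚ
boolToℚ true  = 1ℚ
boolToℚ false = 0ℚ

adjMatrix : ∀ {n} → SimpleGraph n → Matrix n
adjMatrix G i j = boolToℚ (SimpleGraph.adj G i j)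

A-K : (l : ℕ) → Matrix l
A-K l i j = boolToℚ (Data.Bool.not (does (i ≟ j)))

-- Kronecker product; index p ∈ Fin (m*k) corresponds to (quotient p, remainder p),
-- i.e. p = i*k + a (standard Kronecker ordering).
_⊗_ : ∀ {m k} → Matrix m → Matrix k → Matrix (m Data.Nat.* k)
_⊗_ {m} {k} A B p q = A (quotient k p) (quotient k q) * B (remainder {m} k p) (remainder {m} k q)

InEigenspace : ∀ {n} → Matrix n → ℚ → Vector n → Set
InEigenspace M λ′ v = ∀ i → (M ·ᵥ v) i ≡ λ′ * v i

LinIndep : ∀ {n k} → (Fin k → Vector n) → Set
LinIndep {n} {k} vs = (c : Fin k → ℚ) → (∀ i → ∑ (λ r → c r * vs r i) ≡ 0ℚ) → ∀ r → c r ≡ 0ℚ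

HasIndepEigvecs : ∀ {n} → Matrix n → ℚ → ℕ → Set
HasIndepEigvecs {n} M λ′ k =
  Σ (Fin k → Vector n) (λ vs → (∀ r → InEigenspace M λ′ (vs r)) × LinIndep vs)

-- μ_M(λ) = k : the λ-eigenspace of M has dimension exactly k
-- (for diagonalizable M this is the multiplicity of λ; it is 0 if λ is not an eigenvalue).
Multiplicity : ∀ {n} → Matrix n → ℚ → ℕ → Set
Multiplicity M λ′ k = HasIndepEigvecs M λ′ k × ¬ HasIndepEigvecs M λ′ (suc k)

module Submission where

-- A-K l = J − I acts as −1 exactly on the hyperplane ∑ x = 0, which has the basis
-- e_{s+1} − e_0 (s < l − 1). Tensoring a basis of the 1-eigenspace of A with it gives
-- k (l − 1) independent (−1)-eigenvectors of A ⊗ A-K l.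
-- Conversely let y be a (−1)-eigenvector and X i a = y (combine i a), so that
-- A X (J − I) = −X. Summing over columns, the row sums r of X satisfy (l − 1) A r = −r.
-- As A is an integer matrix and l − 1 ≥ 2 this forces r = 0: after clearing
-- denominators, r = −(l − 1) A r makes r divisible by every power of l − 1. Then A X = X,
-- so every column of X is a 1-eigenvector of A and y lies in the span of the k (l − 1)
-- vectors above; hence no k (l − 1) + 1 eigenvectors are independent.

open import Defs
open import Algebra.Bundles using (CommutativeRing)
open import Data.Bool using (true; false; not)
open import Data.Fin as Fin using (Fin; zero; suc; _↑ˡ_; _↑ʳ_; combine; quotient; remainder; punchIn)
open import Data.Fin.Properties using (punchInᵢ≢i; all?; ¬∀⟶∃¬; ∀-cons; remQuot-combine; combine-surjective)
open import Data.Integer as ℤ using (∣_∣)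
import Data.Integer.Properties as ℤ
import Data.Integer.Tactic.RingSolver as ℤ-Solver
open import Data.Nat as ℕ using (ℕ; zero; suc; _<_; _^_; _∸_; s≤s)
open import Data.Nat.Divisibility using (_∣_; divides; ∣⇒≤)
import Data.Nat.Properties as ℕ
open import Data.Product using (∃; ∃₂; _×_; _,_; proj₁; proj₂)
open import Data.Rational using (ℚ; mkℚ; 0ℚ; 1ℚ; _+_; _*_; -_; _-_; ↥_; ↧_; 1/_; ≢-nonZero)
open import Data.Rational.Literals using (fromℤ)
open import Data.Rational.Properties
  using (+-*-commutativeRing; _≟_; toℚᵘ-injective; toℚᵘ-homo-+; toℚᵘ-homo-*; +-identityˡ; +-identityʳ; +-assoc;
         *-zeroˡ; *-zeroʳ; *-identityˡ; *-identityʳ; *-assoc; *-inverseˡ; neg-distribʳ-*)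
import Data.Rational.Unnormalised as ℚᵘ
import Data.Rational.Unnormalised.Properties as ℚᵘ
open import Data.Vec.Functional using (_∷_; tail; removeAt; insertAt)
open import Data.Vec.Functional.Properties using (insertAt-lookup; insertAt-punchIn)
open import Function using (_∘_)
open import Level using (0ℓ)
open import Relation.Binary.PropositionalEquality
open import Relation.Nullary using (¬_)
open import Relation.Nullary.Decidable using (yes; no; does; dec⇒maybe; dec-true; dec-false; decidable-stable)
open import Relation.Nullary.Negation using (contradiction; ¬¬-map)
open import Tactic.RingSolver using (solve-∀)
open import Tactic.RingSolver.Core.AlmostCommutativeRing using (AlmostCommutativeRing; fromCommutativeRing)
open import Algebra.Properties.Ring (CommutativeRing.ring +-*-commutativeRing) using (-1*x≈-x; -‿involutive)
import Algebra.Properties.Semiring.Sum (CommutativeRing.semiring +-*-commutativeRing) as Sum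

-- The zero test lets the solver normalise numeric constants such as - 1ℚ.
ℚ-ring : AlmostCommutativeRing 0ℓ 0ℓ
ℚ-ring = fromCommutativeRing +-*-commutativeRing (λ x → dec⇒maybe (0ℚ ≟ x))

fromℤ-injective : ∀ {a b} → fromℤ a ≡ fromℤ b → a ≡ b
fromℤ-injective = cong ↥_

fromℤ-+ : ∀ a b → fromℤ (a ℤ.+ b) ≡ fromℤ a + fromℤ b
fromℤ-+ a b = toℚᵘ-injective (ℚᵘ.≃-trans (ℚᵘ.*≡* (cross-multiplication a b)) (ℚᵘ.≃-sym (toℚᵘ-homo-+ (fromℤ a) (fromℤ b))))
  where
  cross-multiplication : ∀ a b → (a ℤ.+ b) ℤ.* ℤ.+ 1 ≡ (a ℤ.* ℤ.+ 1 ℤ.+ b ℤ.* ℤ.+ 1) ℤ.* ℤ.+ 1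
  cross-multiplication = ℤ-Solver.solve-∀

fromℤ-* : ∀ a b → fromℤ (a ℤ.* b) ≡ fromℤ a * fromℤ b
fromℤ-* a b = toℚᵘ-injective (ℚᵘ.≃-trans (ℚᵘ.*≡* refl) (ℚᵘ.≃-sym (toℚᵘ-homo-* (fromℤ a) (fromℤ b))))

fromℤ-neg : ∀ a → fromℤ (ℤ.- a) ≡ - fromℤ a
fromℤ-neg (ℤ.+ zero)  = refl
fromℤ-neg ℤ.+[1+ n ]  = refl
fromℤ-neg ℤ.-[1+ n ]  = refl

∑≡sum : ∀ {n} (f : Fin n → ℚ) → ∑ f ≡ Sum.sum f
∑≡sum {zero}  f = refl
∑≡sum {suc n} f = cong (f zero +_) (∑≡sum (f ∘ suc))

∑-cong : ∀ {n} {f g : Fin n → ℚ} → (∀ i → f i ≡ g i) → ∑ f ≡ ∑ g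
∑-cong {f = f} {g} f≗g rewrite ∑≡sum f | ∑≡sum g = Sum.sum-cong-≗ f≗g

∑-zero : ∀ {n} {f : Fin n → ℚ} → (∀ i → f i ≡ 0ℚ) → ∑ f ≡ 0ℚ
∑-zero {n} f≗0 = trans (∑-cong {g = λ _ → 0ℚ} f≗0) (trans (∑≡sum {n} (λ _ → 0ℚ)) (Sum.sum-replicate-zero n))

∑-distrib-+ : ∀ {n} (f g : Fin n → ℚ) → ∑ (λ i → f i + g i) ≡ ∑ f + ∑ g
∑-distrib-+ f g rewrite ∑≡sum f | ∑≡sum g | ∑≡sum (λ i → f i + g i) = Sum.∑-distrib-+ f g

*-distribˡ-∑ : ∀ {n} (x : ℚ) (f : Fin n → ℚ) → x * ∑ f ≡ ∑ (λ i → x * f i)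
*-distribˡ-∑ x f rewrite ∑≡sum f | ∑≡sum (λ i → x * f i) = Sum.*-distribˡ-sum x f

*-distribʳ-∑ : ∀ {n} (x : ℚ) (f : Fin n → ℚ) → ∑ f * x ≡ ∑ (λ i → f i * x)
*-distribʳ-∑ x f rewrite ∑≡sum f | ∑≡sum (λ i → f i * x) = Sum.*-distribʳ-sum x f

∑-comm : ∀ {n m} (f : Fin n → Fin m → ℚ) → ∑ (λ i → ∑ (f i)) ≡ ∑ (λ j → ∑ (λ i → f i j))
∑-comm {n} {m} f = begin
  ∑ (λ i → ∑ (f i))                    ≡⟨ ∑-cong {n} (λ i → ∑≡sum (f i)) ⟩
  ∑ (λ i → Sum.sum (f i))              ≡⟨ ∑≡sum (λ i → Sum.sum (f i)) ⟩
  Sum.sum (λ i → Sum.sum (f i))        ≡⟨ Sum.∑-comm f ⟩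
  Sum.sum (λ j → Sum.sum (λ i → f i j)) ≡˘⟨ ∑≡sum (λ j → Sum.sum (λ i → f i j)) ⟩
  ∑ (λ j → Sum.sum (λ i → f i j))      ≡˘⟨ ∑-cong {m} (λ j → ∑≡sum (λ i → f i j)) ⟩
  ∑ (λ j → ∑ (λ i → f i j))            ∎
  where open ≡-Reasoning

∑-remove : ∀ {n} (p : Fin (suc n)) (f : Fin (suc n) → ℚ) → ∑ f ≡ f p + ∑ (removeAt f p)
∑-remove p f rewrite ∑≡sum f | ∑≡sum (removeAt f p) = Sum.sum-remove f

∑-neg : ∀ {n} (f : Fin n → ℚ) → ∑ (λ i → - f i) ≡ - ∑ f
∑-neg {n} f = begin
  ∑ (λ i → - f i)      ≡⟨ ∑-cong {n} (λ i → sym (-1*x≈-x (f i))) ⟩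
  ∑ (λ i → - 1ℚ * f i) ≡˘⟨ *-distribˡ-∑ (- 1ℚ) f ⟩
  - 1ℚ * ∑ f           ≡⟨ -1*x≈-x (∑ f) ⟩
  - ∑ f                ∎
  where open ≡-Reasoning

∑-distrib-- : ∀ {n} (f g : Fin n → ℚ) → ∑ (λ i → f i - g i) ≡ ∑ f - ∑ g
∑-distrib-- f g = trans (∑-distrib-+ f (λ i → - g i)) (cong (∑ f +_) (∑-neg g))

∑-const : ∀ n (x : ℚ) → ∑ {n} (λ _ → x) ≡ fromℤ (ℤ.+ n) * x
∑-const zero    x = sym (*-zeroˡ x)
∑-const (suc n) x = begin
  x + ∑ {n} (λ _ → x)              ≡⟨ cong (x +_) (∑-const n x) ⟩
  x + fromℤ (ℤ.+ n) * x            ≡⟨ x+yx≡[1+y]x x (fromℤ (ℤ.+ n)) ⟩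
  (1ℚ + fromℤ (ℤ.+ n)) * x         ≡˘⟨ cong (_* x) (fromℤ-+ (ℤ.+ 1) (ℤ.+ n)) ⟩
  fromℤ (ℤ.+ suc n) * x            ∎
  where
  open ≡-Reasoning
  x+yx≡[1+y]x : ∀ x y → x + y * x ≡ (1ℚ + y) * x
  x+yx≡[1+y]x = solve-∀ ℚ-ring

∑-splitAt : ∀ m {n} (f : Fin (m ℕ.+ n) → ℚ) → ∑ f ≡ ∑ (λ i → f (i ↑ˡ n)) + ∑ (λ j → f (m ↑ʳ j))
∑-splitAt zero    f = sym (+-identityˡ (∑ f))
∑-splitAt (suc m) {n} f = trans (cong (f zero +_) (∑-splitAt m {n} (f ∘ suc))) (sym (+-assoc (f zero) _ _))

∑-combine : ∀ m {n} (f : Fin (m ℕ.* n) → ℚ) → ∑ f ≡ ∑ (λ (i : Fin m) → ∑ (λ (a : Fin n) → f (combine i a)))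
∑-combine zero        f = refl
∑-combine (suc m) {n} f = trans (∑-splitAt n f) (cong (∑ (λ a → f (a ↑ˡ m ℕ.* n)) +_) (∑-combine m {n} (λ p → f (n ↑ʳ p))))

δ : ∀ {n} → Fin n → Fin n → ℚ
δ i j = boolToℚ (does (i Fin.≟ j))

δ-refl : ∀ {n} (i : Fin n) → δ i i ≡ 1ℚ
δ-refl i = cong boolToℚ (dec-true (i Fin.≟ i) refl)

δ-≢ : ∀ {n} {i j : Fin n} → i ≢ j → δ i j ≡ 0ℚ
δ-≢ {i = i} {j} i≢j = cong boolToℚ (dec-false (i Fin.≟ j) i≢j)

δ-sym : ∀ {n} (i j : Fin n) → δ i j ≡ δ j i
δ-sym i j with i Fin.≟ j
... | yes refl = sym (δ-refl i)
... | no  i≢j  = sym (δ-≢ (i≢j ∘ sym))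

∑-δ : ∀ {n} (f : Fin n → ℚ) (i : Fin n) → ∑ (λ j → f j * δ j i) ≡ f i
∑-δ {suc n} f i = begin
  ∑ (λ j → f j * δ j i)                                       ≡⟨ ∑-remove i (λ j → f j * δ j i) ⟩
  f i * δ i i + ∑ (λ r → f (punchIn i r) * δ (punchIn i r) i) ≡⟨ cong₂ _+_ (cong (f i *_) (δ-refl i)) (∑-zero off-diagonal) ⟩
  f i * 1ℚ + 0ℚ                                               ≡⟨ trans (+-identityʳ (f i * 1ℚ)) (*-identityʳ (f i)) ⟩
  f i                                                         ∎
  where
  open ≡-Reasoning
  off-diagonal : ∀ r → f (punchIn i r) * δ (punchIn i r) i ≡ 0ℚ
  off-diagonal r = trans (cong (f (punchIn i r) *_) (δ-≢ (punchInᵢ≢i i r))) (*-zeroʳ (f (punchIn i r)))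

-- The eigenvalue −1/d of an integer matrix

Multiple : ℕ → ℚ → Set
Multiple c q = ∃ λ w → q ≡ fromℤ (w ℤ.* ℤ.+ c)

IsInteger : ℚ → Set
IsInteger = Multiple 1

multiple-0 : ∀ {c} → Multiple c 0ℚ
multiple-0 = ℤ.+ 0 , refl

multiple-+ : ∀ {c p q} → Multiple c p → Multiple c q → Multiple c (p + q)
multiple-+ {c} (w₁ , refl) (w₂ , refl) =
  w₁ ℤ.+ w₂ , trans (sym (fromℤ-+ (w₁ ℤ.* ℤ.+ c) (w₂ ℤ.* ℤ.+ c))) (cong fromℤ (sym (ℤ.*-distribʳ-+ (ℤ.+ c) w₁ w₂)))

multiple-∑ : ∀ {c n} {f : Fin n → ℚ} → (∀ j → Multiple c (f j)) → Multiple c (∑ f)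
multiple-∑ {n = zero}  _     = multiple-0
multiple-∑ {n = suc n} mults = multiple-+ (mults zero) (multiple-∑ (mults ∘ suc))

multiple-* : ∀ {c d p q} → Multiple c p → Multiple d q → Multiple (c ℕ.* d) (p * q)
multiple-* {c} {d} (w₁ , refl) (w₂ , refl) = w₁ ℤ.* w₂ , (begin
  fromℤ (w₁ ℤ.* ℤ.+ c) * fromℤ (w₂ ℤ.* ℤ.+ d)     ≡˘⟨ fromℤ-* (w₁ ℤ.* ℤ.+ c) (w₂ ℤ.* ℤ.+ d) ⟩
  fromℤ (w₁ ℤ.* ℤ.+ c ℤ.* (w₂ ℤ.* ℤ.+ d))         ≡⟨ cong fromℤ (ax[by]≡ab[xy] w₁ w₂ (ℤ.+ c) (ℤ.+ d)) ⟩
  fromℤ (w₁ ℤ.* w₂ ℤ.* (ℤ.+ c ℤ.* ℤ.+ d))         ≡˘⟨ cong (λ e → fromℤ (w₁ ℤ.* w₂ ℤ.* e)) (ℤ.pos-* c d) ⟩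
  fromℤ (w₁ ℤ.* w₂ ℤ.* ℤ.+ (c ℕ.* d))             ∎)
  where
  open ≡-Reasoning
  ax[by]≡ab[xy] : ∀ a b x y → a ℤ.* x ℤ.* (b ℤ.* y) ≡ a ℤ.* b ℤ.* (x ℤ.* y)
  ax[by]≡ab[xy] = ℤ-Solver.solve-∀

multiple-neg : ∀ {c q} → Multiple c q → Multiple c (- q)
multiple-neg {c} (w , refl) = ℤ.- w , trans (sym (fromℤ-neg _)) (cong fromℤ (ℤ.neg-distribˡ-* w (ℤ.+ c)))

multiple-integer-* : ∀ {c p q} → IsInteger p → Multiple c q → Multiple c (p * q)
multiple-integer-* {c} p∈ℤ q∈cℤ = subst (λ e → Multiple e _) (ℕ.*-identityˡ c) (multiple-* p∈ℤ q∈cℤ)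

dⁿ∣n⇒n≡0 : ∀ {d} → 1 < d → ∀ n → d ^ n ∣ n → n ≡ 0
dⁿ∣n⇒n≡0 {d} 1<d zero    _    = refl
dⁿ∣n⇒n≡0 {d} 1<d (suc n) dⁿ∣n = contradiction (∣⇒≤ dⁿ∣n) (ℕ.<⇒≱ (n<dⁿ (suc n)))
  where
  n<dⁿ : ∀ n → n < d ^ n
  n<dⁿ zero    = ℕ.z<s
  n<dⁿ (suc n) = ℕ.≤-<-trans (n<dⁿ n) (ℕ.^-monoʳ-< d 1<d (ℕ.n<1+n n))

multiple-of-all-powers⇒≡0 : ∀ {d q} → 1 < d → (∀ m → Multiple (d ^ m) q) → q ≡ 0ℚ
multiple-of-all-powers⇒≡0 {d} {q} 1<d multiples with multiples 0
... | w , q≡z = trans q≡z (cong fromℤ (ℤ.∣i∣≡0⇒i≡0 (dⁿ∣n⇒n≡0 1<d ∣ z ∣ dᶻ∣z)))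
  where
  z = w ℤ.* ℤ.+ 1
  dᶻ∣z : d ^ ∣ z ∣ ∣ ∣ z ∣
  dᶻ∣z with multiples ∣ z ∣
  ... | w′ , q≡w′dᶻ = divides ∣ w′ ∣ (trans (cong ∣_∣ (fromℤ-injective (trans (sym q≡z) q≡w′dᶻ))) (ℤ.abs-* w′ _))

↧*≡↥ : ∀ p → fromℤ (↧ p) * p ≡ fromℤ (↥ p)
↧*≡↥ p@(mkℚ n d-1 _) = toℚᵘ-injective (ℚᵘ.≃-trans (toℚᵘ-homo-* (fromℤ (↧ p)) p) (ℚᵘ.*≡* (begin
  ↧ p ℤ.* n ℤ.* ℤ.+ 1                      ≡⟨ cross-multiplication (↧ p) n ⟩
  n ℤ.* ↧ p                                ≡˘⟨ cong (λ m → n ℤ.* ℤ.+ m) (ℕ.*-identityˡ (suc d-1)) ⟩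
  n ℤ.* ℤ.+ (1 ℕ.* suc d-1)                ∎)))
  where
  open ≡-Reasoning
  cross-multiplication : ∀ x n → x ℤ.* n ℤ.* ℤ.+ 1 ≡ n ℤ.* x
  cross-multiplication = ℤ-Solver.solve-∀

fromℤ-isInteger : ∀ z → IsInteger (fromℤ z)
fromℤ-isInteger z = z , cong fromℤ (sym (ℤ.*-identityʳ z))

x*y≡0⇒y≡0 : ∀ {x y} → x ≢ 0ℚ → x * y ≡ 0ℚ → y ≡ 0ℚ
x*y≡0⇒y≡0 {x} {y} x≢0 xy≡0 = begin
  y              ≡˘⟨ *-identityˡ y ⟩
  1ℚ * y         ≡˘⟨ cong (_* y) (*-inverseˡ x) ⟩
  1/ x * x * y   ≡⟨ *-assoc (1/ x) x y ⟩
  1/ x * (x * y) ≡⟨ cong (1/ x *_) xy≡0 ⟩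
  1/ x * 0ℚ      ≡⟨ *-zeroʳ (1/ x) ⟩
  0ℚ             ∎
  where
  open ≡-Reasoning
  instance _ = ≢-nonZero x≢0

clear-denominators : ∀ {n} (s : Vector n) → ∃ λ D → D ≢ 0ℚ × IsInteger D × (∀ i → IsInteger (D * s i))
clear-denominators {zero}  s = 1ℚ , (λ ()) , fromℤ-isInteger (ℤ.+ 1) , λ ()
clear-denominators {suc n} s with clear-denominators (s ∘ suc)
... | D , D≢0 , D∈ℤ , Ds∈ℤ = d * D , d*D≢0 , multiple-* (fromℤ-isInteger (↧ s₀)) D∈ℤ , dDs∈ℤ
  where
  s₀ = s zero
  d = fromℤ (↧ s₀)
  d*D≢0 : d * D ≢ 0ℚ
  d*D≢0 dD≡0 = D≢0 (x*y≡0⇒y≡0 {d} (λ ()) dD≡0)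
  dDs∈ℤ : ∀ i → IsInteger (d * D * s i)
  dDs∈ℤ zero    = subst IsInteger (y[xz]≡xyz d D s₀) (multiple-* D∈ℤ ds₀∈ℤ)
    where
    ds₀∈ℤ : IsInteger (d * s₀)
    ds₀∈ℤ = subst IsInteger (sym (↧*≡↥ s₀)) (fromℤ-isInteger (↥ s₀))
    y[xz]≡xyz : ∀ x y z → y * (x * z) ≡ x * y * z
    y[xz]≡xyz = solve-∀ ℚ-ring
  dDs∈ℤ (suc i) = subst IsInteger (sym (*-assoc d D (s (suc i)))) (multiple-* (fromℤ-isInteger (↧ s₀)) (Ds∈ℤ i))

IntegerMatrix : ∀ {n} → Matrix n → Set
IntegerMatrix A = ∀ i j → IsInteger (A i j)

·ᵥ-*ˡ : ∀ {n} (M : Matrix n) (x : ℚ) (v : Vector n) i → (M ·ᵥ (λ j → x * v j)) i ≡ x * (M ·ᵥ v) i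
·ᵥ-*ˡ M x v i = trans (∑-cong (λ j → m[xv]≡x[mv] (M i j) x (v j))) (sym (*-distribˡ-∑ x (λ j → M i j * v j)))
  where
  m[xv]≡x[mv] : ∀ m x v → m * (x * v) ≡ x * (m * v)
  m[xv]≡x[mv] = solve-∀ ℚ-ring

InEigenspace−1/ : ∀ {n} → Matrix n → ℕ → Vector n → Set
InEigenspace−1/ A d s = ∀ i → fromℤ (ℤ.+ d) * (A ·ᵥ s) i ≡ - s i

module _ {n} {A : Matrix n} (A∈ℤ : IntegerMatrix A) {d : ℕ} where

  -- t = −d (A t), so divisibility of t by dᵐ propagates to dᵐ⁺¹.
  integer-eigenvector-divisible : ∀ {t} → (∀ i → IsInteger (t i)) → InEigenspace−1/ A d t → ∀ m i → Multiple (d ^ m) (t i)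
  integer-eigenvector-divisible t∈ℤ eig zero    i = t∈ℤ i
  integer-eigenvector-divisible {t} t∈ℤ eig (suc m) i =
    subst (Multiple (d ^ suc m)) (trans (cong -_ (eig i)) (-‿involutive (t i))) (multiple-neg (multiple-* d∈dℤ At∈dᵐℤ))
    where
    d∈dℤ : Multiple d (fromℤ (ℤ.+ d))
    d∈dℤ = ℤ.+ 1 , cong fromℤ (sym (ℤ.*-identityˡ (ℤ.+ d)))
    At∈dᵐℤ : Multiple (d ^ m) ((A ·ᵥ t) i)
    At∈dᵐℤ = multiple-∑ (λ j → multiple-integer-* (A∈ℤ i j) (integer-eigenvector-divisible t∈ℤ eig m j))

  InEigenspace−1/⇒≡0 : 1 < d → ∀ {s} → InEigenspace−1/ A d s → ∀ i → s i ≡ 0ℚ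
  InEigenspace−1/⇒≡0 1<d {s} eig i with clear-denominators s
  ... | D , D≢0 , _ , Ds∈ℤ =
    x*y≡0⇒y≡0 D≢0 (multiple-of-all-powers⇒≡0 1<d (λ m → integer-eigenvector-divisible Ds∈ℤ Deig m i))
    where
    Deig : InEigenspace−1/ A d (λ j → D * s j)
    Deig j = begin
      fromℤ (ℤ.+ d) * (A ·ᵥ (λ j → D * s j)) j ≡⟨ cong (fromℤ (ℤ.+ d) *_) (·ᵥ-*ˡ A D s j) ⟩
      fromℤ (ℤ.+ d) * (D * (A ·ᵥ s) j)        ≡⟨ a[bc]≡b[ac] (fromℤ (ℤ.+ d)) D _ ⟩
      D * (fromℤ (ℤ.+ d) * (A ·ᵥ s) j)        ≡⟨ cong (D *_) (eig j) ⟩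
      D * - s j                               ≡˘⟨ neg-distribʳ-* D (s j) ⟩
      - (D * s j)                             ∎
      where
      open ≡-Reasoning
      a[bc]≡b[ac] : ∀ a b c → a * (b * c) ≡ b * (a * c)
      a[bc]≡b[ac] = solve-∀ ℚ-ring

-- Linear independence and spans

lincomb : ∀ {k n} → (Fin k → ℚ) → (Fin k → Vector n) → Vector n
lincomb c vs i = ∑ (λ r → c r * vs r i)

_∈Span_ : ∀ {k n} → Vector n → (Fin k → Vector n) → Set
y ∈Span vs = ∃ λ α → ∀ i → y i ≡ lincomb α vs i

lincomb-assoc : ∀ {k m n} (c : Fin k → ℚ) (β : Fin k → Vector m) (u : Fin m → Vector n) i →
                lincomb c (λ t → lincomb (β t) u) i ≡ lincomb (lincomb c β) u i
lincomb-assoc c β u i = begin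
  ∑ (λ t → c t * ∑ (λ j → β t j * u j i))   ≡⟨ ∑-cong (λ t → *-distribˡ-∑ (c t) (λ j → β t j * u j i)) ⟩
  ∑ (λ t → ∑ (λ j → c t * (β t j * u j i))) ≡⟨ ∑-comm (λ t j → c t * (β t j * u j i)) ⟩
  ∑ (λ j → ∑ (λ t → c t * (β t j * u j i))) ≡⟨ ∑-cong (λ j → ∑-cong (λ t → sym (*-assoc (c t) (β t j) (u j i)))) ⟩
  ∑ (λ j → ∑ (λ t → c t * β t j * u j i))   ≡˘⟨ ∑-cong (λ j → *-distribʳ-∑ (u j i) (λ t → c t * β t j)) ⟩
  ∑ (λ j → ∑ (λ t → c t * β t j) * u j i)   ∎
  where open ≡-Reasoning

eliminate : ∀ {k n} → Fin (suc k) → (Fin k → ℚ) → (Fin (suc k) → Vector n) → Fin k → Vector n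
eliminate p ρ f r i = f (punchIn p r) i - ρ r * f p i

-- A dependency c among the eliminated vectors is one among f, with coefficient −∑ c ρ at p.
linIndep-eliminate : ∀ {k n} p ρ {f : Fin (suc k) → Vector n} → LinIndep f → LinIndep (eliminate p ρ f)
linIndep-eliminate p ρ {f} f-indep c lincomb≡0 r =
  trans (sym (insertAt-punchIn c p d r)) (f-indep (insertAt c p d) lifted≡0 (punchIn p r))
  where
  d = - ∑ (λ r → c r * ρ r)
  lifted≡0 : ∀ i → lincomb (insertAt c p d) f i ≡ 0ℚ
  lifted≡0 i = begin
    ∑ (λ q → insertAt c p d q * f q i)
      ≡⟨ ∑-remove p (λ q → insertAt c p d q * f q i) ⟩
    insertAt c p d p * f p i + ∑ (λ r → insertAt c p d (punchIn p r) * f (punchIn p r) i)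
      ≡⟨ cong₂ _+_ (cong (_* f p i) (insertAt-lookup c p d))
                   (∑-cong (λ r → cong (_* f (punchIn p r) i) (insertAt-punchIn c p d r))) ⟩
    d * f p i + ∑ (λ r → c r * f (punchIn p r) i)
      ≡⟨ -sx+t≡t-sx (∑ (λ r → c r * ρ r)) (f p i) _ ⟩
    ∑ (λ r → c r * f (punchIn p r) i) - ∑ (λ r → c r * ρ r) * f p i
      ≡⟨ cong (λ e → ∑ (λ r → c r * f (punchIn p r) i) - e) (*-distribʳ-∑ (f p i) (λ r → c r * ρ r)) ⟩
    ∑ (λ r → c r * f (punchIn p r) i) - ∑ (λ r → c r * ρ r * f p i)
      ≡˘⟨ ∑-distrib-- (λ r → c r * f (punchIn p r) i) (λ r → c r * ρ r * f p i) ⟩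
    ∑ (λ r → c r * f (punchIn p r) i - c r * ρ r * f p i)
      ≡⟨ ∑-cong (λ r → ca-cρb≡c[a-ρb] (c r) (f (punchIn p r) i) (ρ r) (f p i)) ⟩
    lincomb c (eliminate p ρ f) i
      ≡⟨ lincomb≡0 i ⟩
    0ℚ ∎
    where
    open ≡-Reasoning
    -sx+t≡t-sx : ∀ s x t → - s * x + t ≡ t - s * x
    -sx+t≡t-sx = solve-∀ ℚ-ring
    ca-cρb≡c[a-ρb] : ∀ c a ρ b → c * a - c * ρ * b ≡ c * (a - ρ * b)
    ca-cρb≡c[a-ρb] = solve-∀ ℚ-ring

linIndep-tail : ∀ {k n} {f : Fin k → Vector (suc n)} → (∀ r → f r zero ≡ 0ℚ) → LinIndep f → LinIndep (λ r → tail (f r))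
linIndep-tail f₀≡0 f-indep c lincomb≡0 = f-indep c λ
  { zero    → ∑-zero (λ r → trans (cong (c r *_) (f₀≡0 r)) (*-zeroʳ (c r)))
  ; (suc i) → lincomb≡0 i }

first-coordinate-eliminable : ∀ {k n} (f : Fin (suc k) → Vector (suc n)) → ∃₂ λ p ρ → ∀ r → eliminate p ρ f r zero ≡ 0ℚ
first-coordinate-eliminable f with all? (λ q → f q zero ≟ 0ℚ)
... | yes f₀≡0 = zero , (λ _ → 0ℚ) , λ r → trans (x-0y≡x (f (suc r) zero) (f zero zero)) (f₀≡0 (suc r))
  where
  x-0y≡x : ∀ x y → x - 0ℚ * y ≡ x
  x-0y≡x = solve-∀ ℚ-ring
... | no ¬f₀≡0 with ¬∀⟶∃¬ _ _ (λ q → f q zero ≟ 0ℚ) ¬f₀≡0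
...   | p , fₚ≢0 = p , (λ r → f (punchIn p r) zero * 1/ fₚ) , λ r → cancels (f (punchIn p r) zero)
  where
  open ≡-Reasoning
  fₚ = f p zero
  instance _ = ≢-nonZero fₚ≢0
  x-xyz≡x-x[yz] : ∀ x y z → x - x * y * z ≡ x - x * (y * z)
  x-xyz≡x-x[yz] = solve-∀ ℚ-ring
  x-x1≡0 : ∀ x → x - x * 1ℚ ≡ 0ℚ
  x-x1≡0 = solve-∀ ℚ-ring
  cancels : ∀ x → x - x * 1/ fₚ * fₚ ≡ 0ℚ
  cancels x = begin
    x - x * 1/ fₚ * fₚ   ≡⟨ x-xyz≡x-x[yz] x (1/ fₚ) fₚ ⟩
    x - x * (1/ fₚ * fₚ) ≡⟨ cong (λ e → x - x * e) (*-inverseˡ fₚ) ⟩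
    x - x * 1ℚ           ≡⟨ x-x1≡0 x ⟩
    0ℚ                   ∎

-- Clearing the first coordinate turns n + 2 independent vectors of ℚⁿ⁺¹ into n + 1
-- independent vectors of ℚⁿ.
¬linIndep-overfull : ∀ n (f : Fin (suc n) → Vector n) → ¬ LinIndep f
¬linIndep-overfull zero    f f-indep with f-indep (λ _ → 1ℚ) (λ ()) zero
... | ()
¬linIndep-overfull (suc n) f f-indep with first-coordinate-eliminable f
... | p , ρ , cleared = ¬linIndep-overfull n (λ r → tail (eliminate p ρ f r))
                          (linIndep-tail {f = eliminate p ρ f} cleared (linIndep-eliminate p ρ {f} f-indep))

∈Span⇒¬linIndep : ∀ {k n} (u : Fin k → Vector n) (x : Fin (suc k) → Vector n) → (∀ t → x t ∈Span u) → ¬ LinIndep x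
∈Span⇒¬linIndep {k} u x spans x-indep = ¬linIndep-overfull k β β-indep
  where
  β = λ t → proj₁ (spans t)
  β-indep : LinIndep β
  β-indep c lincomb≡0 = x-indep c λ i → begin
    lincomb c x i                       ≡⟨ ∑-cong (λ t → cong (c t *_) (proj₂ (spans t) i)) ⟩
    lincomb c (λ t → lincomb (β t) u) i ≡⟨ lincomb-assoc c β u i ⟩
    lincomb (lincomb c β) u i           ≡⟨ ∑-zero (λ j → trans (cong (_* u j i) (lincomb≡0 j)) (*-zeroˡ (u j i))) ⟩
    0ℚ                                  ∎
    where open ≡-Reasoning

¬∈Span⇒linIndep-∷ : ∀ {k n} {v : Fin k → Vector n} {y} → LinIndep v → ¬ y ∈Span v → LinIndep (y ∷ v)
¬∈Span⇒linIndep-∷ {n = n} {v} {y} v-indep y∉span c lincomb≡0 = ∀-cons c₀≡0 rest≡0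
  where
  c₀ = c zero
  T : Fin n → ℚ
  T i = lincomb (c ∘ suc) v i
  y∈span : c₀ ≢ 0ℚ → y ∈Span v
  y∈span c₀≢0 = (λ r → - (1/ c₀) * c (suc r)) , λ i → begin
    y i                                 ≡˘⟨ *-identityˡ (y i) ⟩
    1ℚ * y i                            ≡˘⟨ cong (_* y i) (*-inverseˡ c₀) ⟩
    1/ c₀ * c₀ * y i                    ≡⟨ zcy≡z[cy+t]+[-z]t (1/ c₀) c₀ (y i) (T i) ⟩
    1/ c₀ * (c₀ * y i + T i) + - (1/ c₀) * T i ≡⟨ cong (λ e → 1/ c₀ * e + - (1/ c₀) * T i) (lincomb≡0 i) ⟩
    1/ c₀ * 0ℚ + - (1/ c₀) * T i        ≡⟨ z0+[-z]t≡[-z]t (1/ c₀) (T i) ⟩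
    - (1/ c₀) * T i                     ≡⟨ *-distribˡ-∑ (- (1/ c₀)) (λ r → c (suc r) * v r i) ⟩
    ∑ (λ r → - (1/ c₀) * (c (suc r) * v r i)) ≡⟨ ∑-cong (λ r → sym (*-assoc (- (1/ c₀)) (c (suc r)) (v r i))) ⟩
    lincomb (λ r → - (1/ c₀) * c (suc r)) v i ∎
    where
    open ≡-Reasoning
    instance _ = ≢-nonZero c₀≢0
    zcy≡z[cy+t]+[-z]t : ∀ z c y t → z * c * y ≡ z * (c * y + t) + - z * t
    zcy≡z[cy+t]+[-z]t = solve-∀ ℚ-ring
    z0+[-z]t≡[-z]t : ∀ z t → z * 0ℚ + - z * t ≡ - z * t
    z0+[-z]t≡[-z]t = solve-∀ ℚ-ring
  c₀≡0 : c₀ ≡ 0ℚ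
  c₀≡0 = decidable-stable (c₀ ≟ 0ℚ) (y∉span ∘ y∈span)
  rest≡0 : ∀ r → c (suc r) ≡ 0ℚ
  rest≡0 = v-indep (c ∘ suc) λ i → begin
    T i               ≡˘⟨ +-identityˡ (T i) ⟩
    0ℚ + T i          ≡˘⟨ cong (_+ T i) (*-zeroˡ (y i)) ⟩
    0ℚ * y i + T i    ≡˘⟨ cong (λ e → e * y i + T i) c₀≡0 ⟩
    c₀ * y i + T i    ≡⟨ lincomb≡0 i ⟩
    0ℚ                ∎
    where open ≡-Reasoning

-- Only up to ¬¬: maximality just says that k + 1 eigenvectors are never independent.
maximal-∈Span : ∀ {n k} {M : Matrix n} {μ} {v : Fin k → Vector n} →
                (∀ r → InEigenspace M μ (v r)) → LinIndep v → ¬ HasIndepEigvecs M μ (suc k) →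
                ∀ {y} → InEigenspace M μ y → ¬ ¬ (y ∈Span v)
maximal-∈Span v-eig v-indep maximal y-eig y∉span =
  maximal (_ ∷ _ , (λ { zero → y-eig ; (suc r) → v-eig r }) , ¬∈Span⇒linIndep-∷ v-indep y∉span)

¬¬-Π : ∀ {n} {P : Fin n → Set} → (∀ i → ¬ ¬ P i) → ¬ ¬ (∀ i → P i)
¬¬-Π {zero}  _   ¬∀ = ¬∀ (λ ())
¬¬-Π {suc n} ¬¬P ¬∀ = ¬¬P zero λ P₀ → ¬¬-Π (¬¬P ∘ suc) λ Pₛ → ¬∀ (∀-cons P₀ Pₛ)

-- Kronecker products

quotient-combine : ∀ {m n} (i : Fin m) (a : Fin n) → quotient n (combine i a) ≡ i
quotient-combine i a = cong proj₁ (remQuot-combine i a)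

remainder-combine : ∀ {m n} (i : Fin m) (a : Fin n) → remainder {m} n (combine i a) ≡ a
remainder-combine i a = cong proj₂ (remQuot-combine i a)

∀-combine : ∀ {m n} {P : Fin (m ℕ.* n) → Set} → (∀ i a → P (combine i a)) → ∀ p → P p
∀-combine {m} {n} h p with combine-surjective {m} {n} p
... | i , a , refl = h i a

⊗-·ᵥ : ∀ {m n} (A : Matrix m) (K : Matrix n) (x : Vector (m ℕ.* n)) p →
       ((A ⊗ K) ·ᵥ x) p ≡ ∑ (λ j → ∑ (λ b → A (quotient n p) j * K (remainder {m} n p) b * x (combine j b)))
⊗-·ᵥ {m} {n} A K x p = trans (∑-combine m (λ q → (A ⊗ K) p q * x q)) (∑-cong λ j → ∑-cong λ b →
  cong₂ (λ j′ b′ → A (quotient n p) j′ * K (remainder {m} n p) b′ * x (combine j b))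
        (quotient-combine j b) (remainder-combine j b))

⊗-·ᵥ-combine : ∀ {m n} (A : Matrix m) (K : Matrix n) (x : Vector (m ℕ.* n)) i a →
               ((A ⊗ K) ·ᵥ x) (combine i a) ≡ (K ·ᵥ (λ b → (A ·ᵥ (λ j → x (combine j b))) i)) a
⊗-·ᵥ-combine {m} {n} A K x i a = begin
  ((A ⊗ K) ·ᵥ x) (combine i a)
    ≡⟨ ⊗-·ᵥ A K x (combine i a) ⟩
  ∑ (λ j → ∑ (λ b → A (quotient n (combine i a)) j * K (remainder {m} n (combine i a)) b * x (combine j b)))
    ≡⟨ cong₂ (λ i′ a′ → ∑ (λ j → ∑ (λ b → A i′ j * K a′ b * x (combine j b)))) (quotient-combine i a) (remainder-combine i a) ⟩
  ∑ (λ j → ∑ (λ b → A i j * K a b * x (combine j b)))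
    ≡⟨ ∑-comm (λ j b → A i j * K a b * x (combine j b)) ⟩
  ∑ (λ b → ∑ (λ j → A i j * K a b * x (combine j b)))
    ≡⟨ ∑-cong (λ b → ∑-cong (λ j → xyz≡y[xz] (A i j) (K a b) (x (combine j b)))) ⟩
  ∑ (λ b → ∑ (λ j → K a b * (A i j * x (combine j b))))
    ≡˘⟨ ∑-cong (λ b → *-distribˡ-∑ (K a b) (λ j → A i j * x (combine j b))) ⟩
  (K ·ᵥ (λ b → (A ·ᵥ (λ j → x (combine j b))) i)) a
    ∎
  where
  open ≡-Reasoning
  xyz≡y[xz] : ∀ x y z → x * y * z ≡ y * (x * z)
  xyz≡y[xz] = solve-∀ ℚ-ring

_⊗ᵥ_ : ∀ {m n} → Vector m → Vector n → Vector (m ℕ.* n)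
_⊗ᵥ_ {m} {n} v w p = v (quotient n p) * w (remainder {m} n p)

⊗ᵥ-combine : ∀ {m n} (v : Vector m) (w : Vector n) i a → (v ⊗ᵥ w) (combine i a) ≡ v i * w a
⊗ᵥ-combine v w i a = cong₂ (λ i′ a′ → v i′ * w a′) (quotient-combine i a) (remainder-combine i a)

⊗ᵥ-eigen : ∀ {m n} {A : Matrix m} {K : Matrix n} {α β v w} →
           InEigenspace A α v → InEigenspace K β w → InEigenspace (A ⊗ K) (α * β) (v ⊗ᵥ w)
⊗ᵥ-eigen {m} {n} {A} {K} {α} {β} {v} {w} v-eig w-eig p = begin
  ((A ⊗ K) ·ᵥ (v ⊗ᵥ w)) p
    ≡⟨ ⊗-·ᵥ A K (v ⊗ᵥ w) p ⟩
  ∑ (λ j → ∑ (λ b → A q j * K r b * (v ⊗ᵥ w) (combine j b)))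
    ≡⟨ ∑-cong (λ j → ∑-cong (λ b → trans (cong (A q j * K r b *_) (⊗ᵥ-combine v w j b))
                                         (ak[xy]≡ax[ky] (A q j) (K r b) (v j) (w b)))) ⟩
  ∑ (λ j → ∑ (λ b → A q j * v j * (K r b * w b)))
    ≡˘⟨ ∑-cong (λ j → *-distribˡ-∑ (A q j * v j) (λ b → K r b * w b)) ⟩
  ∑ (λ j → A q j * v j * (K ·ᵥ w) r)
    ≡˘⟨ *-distribʳ-∑ ((K ·ᵥ w) r) (λ j → A q j * v j) ⟩
  (A ·ᵥ v) q * (K ·ᵥ w) r
    ≡⟨ cong₂ _*_ (v-eig q) (w-eig r) ⟩
  α * v q * (β * w r)
    ≡⟨ ak[xy]≡ax[ky] α (v q) β (w r) ⟩
  α * β * (v q * w r)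
    ∎
  where
  open ≡-Reasoning
  q = quotient n p
  r = remainder {m} n p
  ak[xy]≡ax[ky] : ∀ a k x y → a * k * (x * y) ≡ a * x * (k * y)
  ak[xy]≡ax[ky] = solve-∀ ℚ-ring

_⊗ᶠ_ : ∀ {k l m n} → (Fin k → Vector m) → (Fin l → Vector n) → Fin (k ℕ.* l) → Vector (m ℕ.* n)
_⊗ᶠ_ {k} {l} vs ws j = vs (quotient l j) ⊗ᵥ ws (remainder {k} l j)

lincomb-⊗ᶠ : ∀ {k l m n} (c : Fin (k ℕ.* l) → ℚ) (vs : Fin k → Vector m) (ws : Fin l → Vector n) i a →
             lincomb c (vs ⊗ᶠ ws) (combine i a) ≡ lincomb (λ (s : Fin l) → lincomb (λ (r : Fin k) → c (combine r s)) vs i) ws a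
lincomb-⊗ᶠ {k} {l} c vs ws i a = begin
  ∑ (λ j → c j * (vs ⊗ᶠ ws) j (combine i a))
    ≡⟨ ∑-combine k {l} (λ j → c j * (vs ⊗ᶠ ws) j (combine i a)) ⟩
  ∑ (λ (r : Fin k) → ∑ (λ (s : Fin l) → c (combine r s) * (vs ⊗ᶠ ws) (combine r s) (combine i a)))
    ≡⟨ ∑-cong (λ r → ∑-cong (λ s → cong (c (combine r s) *_) (entry r s))) ⟩
  ∑ (λ (r : Fin k) → ∑ (λ (s : Fin l) → c (combine r s) * (vs r i * ws s a)))
    ≡⟨ ∑-comm (λ r s → c (combine r s) * (vs r i * ws s a)) ⟩
  ∑ (λ (s : Fin l) → ∑ (λ (r : Fin k) → c (combine r s) * (vs r i * ws s a)))
    ≡⟨ ∑-cong (λ s → trans (∑-cong (λ r → sym (*-assoc (c (combine r s)) (vs r i) (ws s a))))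
                           (sym (*-distribʳ-∑ (ws s a) (λ r → c (combine r s) * vs r i)))) ⟩
  ∑ (λ s → lincomb (λ r → c (combine r s)) vs i * ws s a)
    ∎
  where
  open ≡-Reasoning
  entry : ∀ r s → (vs ⊗ᶠ ws) (combine r s) (combine i a) ≡ vs r i * ws s a
  entry r s = trans (⊗ᵥ-combine (vs (quotient l (combine r s))) (ws (remainder {k} l (combine r s))) i a)
                    (cong₂ (λ r′ s′ → vs r′ i * ws s′ a) (quotient-combine r s) (remainder-combine r s))

linIndep-⊗ᶠ : ∀ {k l m n} {vs : Fin k → Vector m} {ws : Fin l → Vector n} → LinIndep vs → LinIndep ws → LinIndep (vs ⊗ᶠ ws)
linIndep-⊗ᶠ {vs = vs} {ws} vs-indep ws-indep c lincomb≡0 = ∀-combine λ r s → vs-indep (λ r → c (combine r s)) (λ i → inner≡0 i s) r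
  where
  inner≡0 : ∀ i s → lincomb (λ r → c (combine r s)) vs i ≡ 0ℚ
  inner≡0 i = ws-indep (λ s → lincomb (λ r → c (combine r s)) vs i) λ a →
    trans (sym (lincomb-⊗ᶠ c vs ws i a)) (lincomb≡0 (combine i a))

hasIndepEigvecs-⊗ : ∀ {m n k l} {A : Matrix m} {K : Matrix n} {α β} →
                    HasIndepEigvecs A α k → HasIndepEigvecs K β l → HasIndepEigvecs (A ⊗ K) (α * β) (k ℕ.* l)
hasIndepEigvecs-⊗ {k = k} {l} {A} {K} {α} {β} (vs , vs-eig , vs-indep) (ws , ws-eig , ws-indep) =
  vs ⊗ᶠ ws ,
  (λ j → ⊗ᵥ-eigen {A = A} {K} {α} {β} (vs-eig (quotient l j)) (ws-eig (remainder {k} l j))) ,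
  linIndep-⊗ᶠ vs-indep ws-indep

∈Span-⊗ᶠ : ∀ {k l m n} {vs : Fin k → Vector m} {ws : Fin l → Vector n} (a : Fin l → Vector m) →
           (∀ s → a s ∈Span vs) → (x : Vector (m ℕ.* n)) →
           (∀ i b → x (combine i b) ≡ lincomb (λ s → a s i) ws b) → x ∈Span (vs ⊗ᶠ ws)
∈Span-⊗ᶠ {k} {l} {vs = vs} {ws} a spans x x≡ = β , ∀-combine λ i b → begin
  x (combine i b)                                             ≡⟨ x≡ i b ⟩
  lincomb (λ s → a s i) ws b                                  ≡⟨ ∑-cong (λ s → cong (_* ws s b) (a≡ s i)) ⟩
  lincomb (λ s → lincomb (λ r → β (combine r s)) vs i) ws b  ≡˘⟨ lincomb-⊗ᶠ β vs ws i b ⟩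
  lincomb β (vs ⊗ᶠ ws) (combine i b)                          ∎
  where
  open ≡-Reasoning
  β : Fin (k ℕ.* l) → ℚ
  β j = proj₁ (spans (remainder {k} l j)) (quotient l j)
  β-combine : ∀ r s → β (combine r s) ≡ proj₁ (spans s) r
  β-combine r s = cong₂ (λ s′ r′ → proj₁ (spans s′) r′) (remainder-combine r s) (quotient-combine r s)
  a≡ : ∀ s i → a s i ≡ lincomb (λ r → β (combine r s)) vs i
  a≡ s i = trans (proj₂ (spans s) i) (∑-cong (λ r → cong (_* vs r i) (sym (β-combine r s))))

boolToℚ-not : ∀ b → boolToℚ (not b) ≡ 1ℚ - boolToℚ b
boolToℚ-not true  = refl
boolToℚ-not false = refl

A-K-·ᵥ : ∀ {l} (f : Vector l) a → (A-K l ·ᵥ f) a ≡ ∑ f - f a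
A-K-·ᵥ {l} f a = begin
  ∑ (λ b → A-K l a b * f b)        ≡⟨ ∑-cong entry ⟩
  ∑ (λ b → f b - f b * δ b a)      ≡⟨ ∑-distrib-- f (λ b → f b * δ b a) ⟩
  ∑ f - ∑ (λ b → f b * δ b a)      ≡⟨ cong (λ e → ∑ f - e) (∑-δ f a) ⟩
  ∑ f - f a                        ∎
  where
  open ≡-Reasoning
  [1-d]x≡x-xd : ∀ d x → (1ℚ - d) * x ≡ x - x * d
  [1-d]x≡x-xd = solve-∀ ℚ-ring
  entry : ∀ b → A-K l a b * f b ≡ f b - f b * δ b a
  entry b = trans (cong (_* f b) (trans (boolToℚ-not (does (a Fin.≟ b))) (cong (λ e → 1ℚ - e) (δ-sym a b))))
                  ([1-d]x≡x-xd (δ b a) (f b))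

∑≡0⇒A-K-eigen : ∀ {l} {w : Vector l} → ∑ w ≡ 0ℚ → InEigenspace (A-K l) (- 1ℚ) w
∑≡0⇒A-K-eigen {w = w} ∑w≡0 a = begin
  (A-K _ ·ᵥ w) a  ≡⟨ A-K-·ᵥ w a ⟩
  ∑ w - w a       ≡⟨ cong (_- w a) ∑w≡0 ⟩
  0ℚ - w a        ≡⟨ 0-x≡-1x (w a) ⟩
  - 1ℚ * w a      ∎
  where
  open ≡-Reasoning
  0-x≡-1x : ∀ x → 0ℚ - x ≡ - 1ℚ * x
  0-x≡-1x = solve-∀ ℚ-ring

sumZeroBasis : ∀ {L} → Fin L → Vector (suc L)
sumZeroBasis s zero    = - 1ℚ
sumZeroBasis s (suc b) = δ s b

∑-sumZeroBasis : ∀ {L} (s : Fin L) → ∑ (sumZeroBasis s) ≡ 0ℚ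
∑-sumZeroBasis s = cong (- 1ℚ +_) (begin
  ∑ (δ s)                  ≡⟨ ∑-cong (λ b → trans (δ-sym s b) (sym (*-identityˡ (δ b s)))) ⟩
  ∑ (λ b → 1ℚ * δ b s)     ≡⟨ ∑-δ (λ _ → 1ℚ) s ⟩
  1ℚ                       ∎)
  where open ≡-Reasoning

sumZeroBasis-linIndep : ∀ {L} → LinIndep (sumZeroBasis {L})
sumZeroBasis-linIndep c lincomb≡0 s = trans (sym (∑-δ c s)) (lincomb≡0 (suc s))

A-K-eigenvectors : ∀ L → HasIndepEigvecs (A-K (suc L)) (- 1ℚ) L
A-K-eigenvectors L = sumZeroBasis , (λ s → ∑≡0⇒A-K-eigen {w = sumZeroBasis s} (∑-sumZeroBasis s)) , sumZeroBasis-linIndep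

sumZero-expansion : ∀ {L} (x : Vector (suc L)) → ∑ x ≡ 0ℚ → ∀ a → x a ≡ lincomb (tail x) sumZeroBasis a
sumZero-expansion x ∑x≡0 zero = begin
  x zero                              ≡⟨ a≡a+t+t[-1] (x zero) (∑ (tail x)) ⟩
  (x zero + ∑ (tail x)) + ∑ (tail x) * - 1ℚ ≡⟨ cong (λ e → e + ∑ (tail x) * - 1ℚ) ∑x≡0 ⟩
  0ℚ + ∑ (tail x) * - 1ℚ              ≡⟨ +-identityˡ _ ⟩
  ∑ (tail x) * - 1ℚ                   ≡⟨ *-distribʳ-∑ (- 1ℚ) (tail x) ⟩
  lincomb (tail x) sumZeroBasis zero  ∎
  where
  open ≡-Reasoning
  a≡a+t+t[-1] : ∀ a t → a ≡ a + t + t * - 1ℚ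
  a≡a+t+t[-1] = solve-∀ ℚ-ring
sumZero-expansion x ∑x≡0 (suc b) = sym (∑-δ (tail x) b)

-- The (−1)-eigenspace of A ⊗ A-K l

module MinusOneEigenvector {n} {A : Matrix n} (A∈ℤ : IntegerMatrix A) {L} (1<L : 1 < L)
                           {y : Vector (n ℕ.* suc L)} (y-eig : InEigenspace (A ⊗ A-K (suc L)) (- 1ℚ) y) where

  column : Fin (suc L) → Vector n
  column a i = y (combine i a)

  rowSum : Vector n
  rowSum i = ∑ (λ a → y (combine i a))

  private
    C : Fin n → Fin (suc L) → ℚ
    C i b = (A ·ᵥ column b) i

  ∑-columns : ∀ i → ∑ (C i) ≡ (A ·ᵥ rowSum) i
  ∑-columns i = begin
    ∑ (λ b → ∑ (λ j → A i j * y (combine j b)))  ≡⟨ ∑-comm (λ b j → A i j * y (combine j b)) ⟩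
    ∑ (λ j → ∑ (λ b → A i j * y (combine j b)))  ≡˘⟨ ∑-cong (λ j → *-distribˡ-∑ (A i j) (λ b → y (combine j b))) ⟩
    (A ·ᵥ rowSum) i                               ∎
    where open ≡-Reasoning

  -- Entry (i, a) of A X (J − I) = −X, where X i a = y (combine i a).
  column-equation : ∀ i a → ∑ (C i) - C i a ≡ - y (combine i a)
  column-equation i a = begin
    ∑ (C i) - C i a                        ≡˘⟨ A-K-·ᵥ (C i) a ⟩
    (A-K (suc L) ·ᵥ C i) a                 ≡˘⟨ ⊗-·ᵥ-combine A (A-K (suc L)) y i a ⟩
    ((A ⊗ A-K (suc L)) ·ᵥ y) (combine i a) ≡⟨ y-eig (combine i a) ⟩
    - 1ℚ * y (combine i a)                 ≡⟨ -1*x≈-x (y (combine i a)) ⟩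
    - y (combine i a)                      ∎
    where open ≡-Reasoning

  rowSum-equation : InEigenspace−1/ A L rowSum
  rowSum-equation i = begin
    fromℤ (ℤ.+ L) * (A ·ᵥ rowSum) i           ≡˘⟨ cong (fromℤ (ℤ.+ L) *_) (∑-columns i) ⟩
    fromℤ (ℤ.+ L) * S                         ≡⟨ ls≡s+ls-s (fromℤ (ℤ.+ L)) S ⟩
    S + fromℤ (ℤ.+ L) * S - S                 ≡˘⟨ cong (λ e → S + e - S) (∑-const L S) ⟩
    ∑ {suc L} (λ _ → S) - ∑ (C i)             ≡˘⟨ ∑-distrib-- (λ _ → S) (C i) ⟩
    ∑ (λ a → S - C i a)                       ≡⟨ ∑-cong (column-equation i) ⟩
    ∑ (λ a → - y (combine i a))               ≡⟨ ∑-neg (λ a → y (combine i a)) ⟩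
    - rowSum i                                ∎
    where
    open ≡-Reasoning
    S = ∑ (C i)
    ls≡s+ls-s : ∀ l s → l * s ≡ s + l * s - s
    ls≡s+ls-s = solve-∀ ℚ-ring

  rowSum≡0 : ∀ i → rowSum i ≡ 0ℚ
  rowSum≡0 = InEigenspace−1/⇒≡0 A∈ℤ 1<L rowSum-equation

  column-eigen : ∀ a → InEigenspace A 1ℚ (column a)
  column-eigen a i = begin
    C i a                    ≡⟨ x≡-[0-x] (C i a) ⟩
    - (0ℚ - C i a)           ≡˘⟨ cong (λ e → - (e - C i a)) ∑C≡0 ⟩
    - (∑ (C i) - C i a)      ≡⟨ cong -_ (column-equation i a) ⟩
    - - y (combine i a)      ≡⟨ -‿involutive (y (combine i a)) ⟩
    y (combine i a)          ≡˘⟨ *-identityˡ (y (combine i a)) ⟩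
    1ℚ * column a i          ∎
    where
    open ≡-Reasoning
    x≡-[0-x] : ∀ x → x ≡ - (0ℚ - x)
    x≡-[0-x] = solve-∀ ℚ-ring
    ∑C≡0 : ∑ (C i) ≡ 0ℚ
    ∑C≡0 = trans (∑-columns i) (∑-zero (λ j → trans (cong (A i j *_) (rowSum≡0 j)) (*-zeroʳ (A i j))))

  ∈Span-⊗ᶠ-basis : ∀ {k} {v : Fin k → Vector n} → (∀ r → InEigenspace A 1ℚ (v r)) → LinIndep v →
                   ¬ HasIndepEigvecs A 1ℚ (suc k) → ¬ ¬ (y ∈Span (v ⊗ᶠ sumZeroBasis))
  ∈Span-⊗ᶠ-basis v-eig v-indep maximal =
    ¬¬-map (λ spans → ∈Span-⊗ᶠ (column ∘ suc) spans y (λ i → sumZero-expansion (λ a → y (combine i a)) (rowSum≡0 i)))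
           (¬¬-Π (λ s → maximal-∈Span {M = A} {1ℚ} v-eig v-indep maximal (column-eigen (suc s))))

hasIndepEigvecs-⊗-A-K : ∀ {n k} {A : Matrix n} L → HasIndepEigvecs A 1ℚ k →
                        HasIndepEigvecs (A ⊗ A-K (suc L)) (- 1ℚ) (k ℕ.* L)
hasIndepEigvecs-⊗-A-K {A = A} L basis = hasIndepEigvecs-⊗ {A = A} {A-K (suc L)} {1ℚ} {β = - 1ℚ} basis (A-K-eigenvectors L)

¬hasIndepEigvecs-⊗-A-K : ∀ {n k L} {A : Matrix n} → IntegerMatrix A → 1 < L → Multiplicity A 1ℚ k →
                         ¬ HasIndepEigvecs (A ⊗ A-K (suc L)) (- 1ℚ) (suc (k ℕ.* L))
¬hasIndepEigvecs-⊗-A-K A∈ℤ 1<L ((v , v-eig , v-indep) , maximal) (x , x-eig , x-indep) =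
  ¬¬-Π (λ t → MinusOneEigenvector.∈Span-⊗ᶠ-basis A∈ℤ 1<L (x-eig t) v-eig v-indep maximal)
       (λ spans → ∈Span⇒¬linIndep (v ⊗ᶠ sumZeroBasis) x spans x-indep)

adjMatrix-integer : ∀ {n} (G : SimpleGraph n) → IntegerMatrix (adjMatrix G)
adjMatrix-integer G i j with SimpleGraph.adj G i j
... | true  = fromℤ-isInteger (ℤ.+ 1)
... | false = fromℤ-isInteger (ℤ.+ 0)

lemma4p5 : ∀ {n} (G : SimpleGraph n) (l : ℕ) → 2 < l → (k : ℕ) →
    Multiplicity (adjMatrix G) 1ℚ k →
    Multiplicity (adjMatrix G ⊗ A-K l) (- 1ℚ) ((l ∸ 1) ℕ.* k)
lemma4p5 G (suc L) (s≤s 1<L) k multiplicity@(basis , _) =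
  subst (HasIndepEigvecs B (- 1ℚ)) (ℕ.*-comm k L) (hasIndepEigvecs-⊗-A-K {A = adjMatrix G} L basis) ,
  subst (¬_ ∘ HasIndepEigvecs B (- 1ℚ) ∘ suc) (ℕ.*-comm k L)
        (¬hasIndepEigvecs-⊗-A-K (adjMatrix-integer G) 1<L multiplicity)
  where
  B = adjMatrix G ⊗ A-K (suc L)
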